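{- For any type $A$ and family $\mathcal{B}(x)$ of path objects indexed by $x:A$, the coproduct reflexive graph $\coprod_{x:A}\mathcal{B}(x)$ is a path object.
   Context: Intensional Martin-Löf type theory with $\Pi,\Sigma$, identity types. A reflexive graph $\mathcal{G}$: type $|\mathcal{G}|$, edge types $x\approx_{\mathcal{G}}y$, $\mathsf{rx}_{\mathcal{G}}(x):x\approx_{\mathcal{G}}x$; a path object if every fan $\sum_yx\approx_{\mathcal{G}}y$ is a proposition. The coproduct $\coprod_{x:A}\mathcal{B}(x)$ has vertices $\sum_{x:A}|\mathcal{B}(x)|$, edges $(a_0,b_0)\approx(a_1,b_1):=\sum_{p:a_0=_Aa_1}p_*b_0\approx_{\mathcal{B}(a_1)}b_1$ (where $p_*$ is transport in the family $x\mapsto|\mathcal{B}(x)|$), and reflexivity $(\mathsf{refl},\mathsf{rx}_{\mathcal{B}(a)}(b))$. -}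

{-# OPTIONS --without-K #-}
module Defs where

open import Level using (Level; _⊔_; suc)
open import Data.Product using (Σ; _,_; proj₁; proj₂)
open import Relation.Binary.PropositionalEquality using (_≡_; refl; subst)

record ReflGraph (ℓ₀ ℓ₁ : Level) : Set (suc (ℓ₀ ⊔ ℓ₁)) where
  field
    ∣_∣ : Set ℓ₀
    _≈_ : ∣_∣ → ∣_∣ → Set ℓ₁
    rx  : (x : ∣_∣) → x ≈ x
open ReflGraph public

isProp : {ℓ : Level} → Set ℓ → Set ℓ
isProp X = (a b : X) → a ≡ b

Fan : {ℓ₀ ℓ₁ : Level} (G : ReflGraph ℓ₀ ℓ₁) → ∣ G ∣ → Set (ℓ₀ ⊔ ℓ₁)
Fan G x = Σ (∣ G ∣) (λ y → _≈_ G x y)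

isPathObject : {ℓ₀ ℓ₁ : Level} → ReflGraph ℓ₀ ℓ₁ → Set (ℓ₀ ⊔ ℓ₁)
isPathObject G = (x : ∣ G ∣) → isProp (Fan G x)

Coprod : {ℓ ℓ₀ ℓ₁ : Level} (A : Set ℓ) → (A → ReflGraph ℓ₀ ℓ₁) → ReflGraph (ℓ ⊔ ℓ₀) (ℓ ⊔ ℓ₁)
Coprod A B = record
  { ∣_∣ = Σ A (λ x → ∣ B x ∣)
  ; _≈_ = λ u v → Σ (proj₁ u ≡ proj₁ v)
                    (λ p → _≈_ (B (proj₁ v)) (subst (λ x → ∣ B x ∣) p (proj₂ u)) (proj₂ v))
  ; rx  = λ u → refl , rx (B (proj₁ u)) (proj₂ u)
  }

module Submission where

-- Every element ((a′ , b′) , p , e) of a coproduct fan at (a , b) equals the reflexivity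
-- edge: path induction on p : a ≡ a′ leaves an edge out of b in B a, and the fan of B a at
-- b is a proposition.

open import Defs
open import Level using (Level)
open import Data.Product using (_,_)
open import Relation.Binary.PropositionalEquality using (_≡_; refl; sym; trans; cong)

isProp-if-≡-centre : {ℓ : Level} {X : Set ℓ} (c : X) → ((x : X) → x ≡ c) → isProp X
isProp-if-≡-centre c contract x y = trans (contract x) (sym (contract y))

reflFan : {ℓ₀ ℓ₁ : Level} (G : ReflGraph ℓ₀ ℓ₁) (x : ∣ G ∣) → Fan G x
reflFan G x = x , rx G x

Coprod-fan≡reflFan : {ℓ ℓ₀ ℓ₁ : Level} {A : Set ℓ} (B : A → ReflGraph ℓ₀ ℓ₁)
  → ((x : A) → isPathObject (B x)) → ∀ a b
  → (f : Fan (Coprod A B) (a , b)) → f ≡ reflFan (Coprod A B) (a , b)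
Coprod-fan≡reflFan B H a b ((.a , b′) , refl , e) =
  cong (λ { (y , d) → (a , y) , refl , d }) (H a b (b′ , e) (reflFan (B a) b))

mainTheorem14 : {ℓ ℓ₀ ℓ₁ : Level} (A : Set ℓ) (B : A → ReflGraph ℓ₀ ℓ₁)
    → ((x : A) → isPathObject (B x))
    → isPathObject (Coprod A B)
mainTheorem14 A B H (a , b) =
  isProp-if-≡-centre (reflFan (Coprod A B) (a , b)) (Coprod-fan≡reflFan B H a b)
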